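{- Every complete standard system that does not have contraction $(\mathsf C)$ among its rules contains $\mathbf{Np}$.
   Context: Formulas are built from literals (propositional variables $P$ and their complements $\bar P$) using $\wedge$ and $\vee$. Negation satisfies $\neg P=\bar P$ and is extended by De Morgan's laws. A sequent is a nonempty finite multiset of formulas. A comma denotes multiset union, and $\Gamma,\Delta,\Sigma$ denote possibly empty multisets. A formula is valid if it evaluates to $1$ under every $0/1$-assignment. Rules: - Axiom: infer $P,\neg P$ from no premises. - $(\&)$: from $\Gamma,A$ and $\Gamma,B$ infer $\Gamma,A\wedge B$. - $(\otimes)$: from $\Delta,A$ and $\Sigma,B$ infer $\Delta,\Sigma,A\wedge B$. - $(\oplus)$: consists of both $(\oplus_1)$ and $(\oplus_2)$, where $(\oplus_i)$ infers $\Gamma,A_1\vee A_2$ from $\Gamma,A_i$. - $(\mathrm{par})$: from $\Gamma,A,B$ infer $\Gamma,A\vee B$. - $(\mathsf W)$: from $\Gamma$ infer $\Gamma,A$. - $(\mathsf C)$: from $\Gamma,A,A$ infer $\Gamma,A$. A standard system is the axiom together with any subset of $\{(\&),(\otimes),(\oplus),(\mathrm{par}),(\mathsf W),(\mathsf C)\}$. $\mathbf{Np}$ is the axiom together with $(\&),(\mathrm{par}),(\mathsf W)$. A rule is derivable in $S$ if, for every instance of it, the conclusion is derivable in $S$ from its premises used as extra leaves. $S$ contains $T$ if every rule of $T$ is derivable in $S$. A system is complete if every valid formula is derivable in it. -}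

module Defs where

open import Data.Nat using (ℕ)
open import Data.Bool using (Bool; true; false; not; _∧_; _∨_)
open import Data.List using (List; []; _∷_; _++_; [_])
open import Data.List.Membership.Propositional using (_∈_)
open import Data.List.Relation.Binary.Permutation.Propositional using (_↭_)
open import Data.Empty using (⊥)
open import Data.Product using (_×_)
open import Relation.Binary.PropositionalEquality using (_≡_; _≢_)

data Formula : Set where
  pos  : ℕ → Formula
  neg  : ℕ → Formula
  _∧ᶠ_ : Formula → Formula → Formula
  _∨ᶠ_ : Formula → Formula → Formula

¬ᶠ_ : Formula → Formula
¬ᶠ pos n   = neg n
¬ᶠ neg n   = pos n
¬ᶠ (A ∧ᶠ B) = (¬ᶠ A) ∨ᶠ (¬ᶠ B)
¬ᶠ (A ∨ᶠ B) = (¬ᶠ A) ∧ᶠ (¬ᶠ B)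

eval : (ℕ → Bool) → Formula → Bool
eval v (pos n)  = v n
eval v (neg n)  = not (v n)
eval v (A ∧ᶠ B) = eval v A ∧ eval v B
eval v (A ∨ᶠ B) = eval v A ∨ eval v B

Valid : Formula → Set
Valid A = ∀ (v : ℕ → Bool) → eval v A ≡ true

-- Sequents: finite multisets, represented by lists taken up to
-- permutation (the derivability predicate below is closed under _↭_).
-- Comma = list append.

Sequent : Set
Sequent = List Formula

data RuleName : Set where
  &R ⊗R ⊕R parR WR CR : RuleName

data Inst1 : RuleName → Sequent → Sequent → Set where
  ⊕₁   : ∀ Γ A₁ A₂ → Inst1 ⊕R (Γ ++ [ A₁ ]) (Γ ++ [ A₁ ∨ᶠ A₂ ])
  ⊕₂   : ∀ Γ A₁ A₂ → Inst1 ⊕R (Γ ++ [ A₂ ]) (Γ ++ [ A₁ ∨ᶠ A₂ ])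
  par  : ∀ Γ A B → Inst1 parR (Γ ++ A ∷ B ∷ []) (Γ ++ [ A ∨ᶠ B ])
  -- the premise Γ of weakening must be a sequent, i.e. nonempty
  weak : ∀ Γ A → Γ ≢ [] → Inst1 WR Γ (Γ ++ [ A ])
  contr : ∀ Γ A → Inst1 CR (Γ ++ A ∷ A ∷ []) (Γ ++ [ A ])

data Inst2 : RuleName → Sequent → Sequent → Sequent → Set where
  with& : ∀ Γ A B → Inst2 &R (Γ ++ [ A ]) (Γ ++ [ B ]) (Γ ++ [ A ∧ᶠ B ])
  tens  : ∀ Δ Σ A B → Inst2 ⊗R (Δ ++ [ A ]) (Σ ++ [ B ]) (Δ ++ Σ ++ [ A ∧ᶠ B ])

-- A standard system: the axiom together with a subset of the rules.

System : Set
System = RuleName → Bool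

data Deriv (S : System) (H : Sequent → Set) : Sequent → Set where
  leaf : ∀ {Γ} → H Γ → Deriv S H Γ
  ax   : ∀ n → Deriv S H (pos n ∷ ¬ᶠ pos n ∷ [])
  rule1 : ∀ {r Γ Δ} → S r ≡ true → Inst1 r Γ Δ → Deriv S H Γ → Deriv S H Δ
  rule2 : ∀ {r Γ₁ Γ₂ Δ} → S r ≡ true → Inst2 r Γ₁ Γ₂ Δ →
          Deriv S H Γ₁ → Deriv S H Γ₂ → Deriv S H Δ
  -- sequents are multisets
  perm : ∀ {Γ Δ} → Γ ↭ Δ → Deriv S H Γ → Deriv S H Δ

Derivable : System → Sequent → Set
Derivable S = Deriv S (λ _ → ⊥)

Complete : System → Set
Complete S = ∀ A → Valid A → Derivable S [ A ]

DerivableRule : System → RuleName → Set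
DerivableRule S r =
  (∀ Γ Δ → Inst1 r Γ Δ → Deriv S (λ Θ → Θ ≡ Γ) Δ) ×
  (∀ Γ₁ Γ₂ Δ → Inst2 r Γ₁ Γ₂ Δ → Deriv S (λ Θ → Θ ∈ Γ₁ ∷ Γ₂ ∷ []) Δ)

-- S contains T: every rule of T is derivable in S (the axiom is shared).
Contains : System → System → Set
Contains S T = ∀ r → T r ≡ true → DerivableRule S r

Np : System
Np &R   = true
Np parR = true
Np WR   = true
Np ⊗R   = false
Np ⊕R   = false
Np CR   = false

{-# OPTIONS --safe #-}
module Submission where

open import Defs
open import Algebra.Properties.CommutativeSemigroup using (interchange)
open import Data.Bool using (Bool; true; false; if_then_else_)
open import Data.Bool.Properties using (¬-not)
open import Data.Empty using (⊥; ⊥-elim)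
open import Data.List using ([]; _∷_; _++_; [_]; map; length)
open import Data.List.Membership.Propositional using (_∈_)
open import Data.List.Membership.Propositional.Properties using (∈-++⁺ʳ)
open import Data.List.Properties using (++-assoc; ++-identityʳ; map-++)
open import Data.List.Relation.Binary.Permutation.Propositional
  using (_↭_; swap; ↭-refl; ↭-trans; ↭-sym)
open import Data.List.Relation.Binary.Permutation.Propositional.Properties
  using (drop-mid; ++⁺ʳ; ∈-resp-↭; map⁺; ↭-length; All-resp-↭)
open import Data.List.Relation.Unary.All using (All; []; _∷_)
open import Data.List.Relation.Unary.All.Properties using (++⁻ʳ)
open import Data.List.Relation.Unary.Any using (here; there)
open import Data.Nat using (ℕ; zero; suc; pred; _+_; _≤_; _<_; z≤n; s≤s; s≤s⁻¹)
open import Data.Nat.ListAction using (sum)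
open import Data.Nat.ListAction.Properties using (sum-++; sum-↭)
open import Data.Nat.Properties
  using ( +-assoc; +-suc; +-identityʳ; +-mono-≤; +-monoʳ-≤; ≤-trans; ≤-refl
        ; m≤m+n; m≤n+m; n≤1+n; 1+n≰n; +-commutativeSemigroup)
open import Data.Product using (_,_)
open import Function using (const; case_of_)
open import Relation.Binary.PropositionalEquality
  using (_≡_; refl; sym; trans; cong; subst; module ≡-Reasoning)
open import Relation.Nullary using (¬_)

-- Each of (&), (par) and (W) is forced by completeness: for each one we give an
-- invariant of all derivations in a system lacking that rule and contraction, and a
-- valid formula whose singleton sequent violates it.
--  * Without (par) no rule shortens a sequent, so every derivable sequent has at least
--    two formulas, while P ∨ P̄ is valid.
--  * Without (&), weigh literals 1, disjunctions additively and A ∧ B as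
--    (w A − 1) + (w B − 1). Each premise of (⊗) weighs at least 2 and loses one unit,
--    so derivable sequents keep weight at least 2, while P ∨ (P̄ ∧ P̄) weighs 1.
--  * Without (W), a proof of F = P̄ ∨ ((P ∧ (P ∧ Q)) ∨ Q̄) can only pass through
--    P̄ , P ∧ (P ∧ Q) , Q̄, and from there (&) leaves P̄ , P , Q̄, which would need
--    weakening, while (⊗) must give the single true formula under P := 0, Q := 1
--    to both premises.

rule-absent : ∀ {b : Bool} → b ≡ false → b ≡ true → ⊥
rule-absent off on with () ← trans (sym off) on

enabled-rule-derivable : ∀ {S : System} {r} → S r ≡ true → DerivableRule S r
enabled-rule-derivable on =
  (λ _ _ i → rule1 on i (leaf refl)) ,
  (λ _ _ _ i → rule2 on i (leaf (here refl)) (leaf (there (here refl))))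

record Invariant (S : System) (I : Sequent → Set) : Set where
  field
    resp-↭ : ∀ {Γ Δ} → Γ ↭ Δ → I Γ → I Δ
    axiom  : ∀ n → I (pos n ∷ neg n ∷ [])
    rule₁  : ∀ {r Γ Δ} → S r ≡ true → Inst1 r Γ Δ → I Γ → I Δ
    rule₂  : ∀ {r Γ₁ Γ₂ Δ} → S r ≡ true → Inst2 r Γ₁ Γ₂ Δ → I Γ₁ → I Γ₂ → I Δ

invariant-holds : ∀ {S I Γ} → Invariant S I → Derivable S Γ → I Γ
invariant-holds inv (ax n)            = Invariant.axiom inv n
invariant-holds inv (rule1 on i d)    = Invariant.rule₁ inv on i (invariant-holds inv d)
invariant-holds inv (rule2 on i d e)  =
  Invariant.rule₂ inv on i (invariant-holds inv d) (invariant-holds inv e)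
invariant-holds inv (perm p d)        = Invariant.resp-↭ inv p (invariant-holds inv d)

+-positive : ∀ g {x y} → (0 < x → 0 < y) → 0 < g + x → 0 < g + y
+-positive zero    f h = f h
+-positive (suc g) _ _ = s≤s z≤n

+-positive₂ : ∀ g {x y z} → (0 < x → 0 < y → 0 < z) → 0 < g + x → 0 < g + y → 0 < g + z
+-positive₂ zero    f h₁ h₂ = f h₁ h₂
+-positive₂ (suc g) _ _  _  = s≤s z≤n

+-positive-⊗ : ∀ d s {a b c} → (0 < a → 0 < b → 0 < c) → 0 < d + a → 0 < s + b → 0 < (d + s) + c
+-positive-⊗ zero    zero    f h₁ h₂ = f h₁ h₂
+-positive-⊗ zero    (suc s) _ _  _  = s≤s z≤n
+-positive-⊗ (suc d) _       _ _  _  = s≤s z≤n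

module Weight (w : Formula → ℕ) where

  ‖_‖ : Sequent → ℕ
  ‖ Γ ‖ = sum (map w Γ)

  ‖‖-++ : ∀ Γ Δ → ‖ Γ ++ Δ ‖ ≡ ‖ Γ ‖ + ‖ Δ ‖
  ‖‖-++ Γ Δ = trans (cong sum (map-++ w Γ Δ)) (sum-++ (map w Γ) (map w Δ))

  ‖‖-↭ : ∀ {Γ Δ} → Γ ↭ Δ → ‖ Γ ‖ ≡ ‖ Δ ‖
  ‖‖-↭ p = sum-↭ (map⁺ w p)

  ‖‖-∷ʳ : ∀ Γ A → ‖ Γ ++ [ A ] ‖ ≡ ‖ Γ ‖ + w A
  ‖‖-∷ʳ Γ A = trans (‖‖-++ Γ [ A ]) (cong (‖ Γ ‖ +_) (+-identityʳ (w A)))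

  ‖‖-∷ʳ-mono : ∀ Γ {A B} → w A ≤ w B → ‖ Γ ++ [ A ] ‖ ≤ ‖ Γ ++ [ B ] ‖
  ‖‖-∷ʳ-mono Γ {A} {B} wA≤wB
    rewrite ‖‖-∷ʳ Γ A | ‖‖-∷ʳ Γ B = +-monoʳ-≤ ‖ Γ ‖ wA≤wB

  ‖‖-≤-++ : ∀ Γ Δ → ‖ Γ ‖ ≤ ‖ Γ ++ Δ ‖
  ‖‖-≤-++ Γ Δ rewrite ‖‖-++ Γ Δ = m≤m+n ‖ Γ ‖ ‖ Δ ‖

  ‖‖-⊗ : ∀ Δ Σ C → ‖ Δ ++ Σ ++ [ C ] ‖ ≡ (‖ Δ ‖ + ‖ Σ ‖) + w C
  ‖‖-⊗ Δ Σ C = begin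
    ‖ Δ ++ Σ ++ [ C ] ‖       ≡⟨ ‖‖-++ Δ (Σ ++ [ C ]) ⟩
    ‖ Δ ‖ + ‖ Σ ++ [ C ] ‖   ≡⟨ cong (‖ Δ ‖ +_) (‖‖-∷ʳ Σ C) ⟩
    ‖ Δ ‖ + (‖ Σ ‖ + w C)    ≡⟨ sym (+-assoc ‖ Δ ‖ ‖ Σ ‖ (w C)) ⟩
    (‖ Δ ‖ + ‖ Σ ‖) + w C    ∎
    where open ≡-Reasoning

  ‖‖-∷ʳ≤‖‖-insert : ∀ Δ Σ {A C} → w A ≤ w C → ‖ Δ ++ [ A ] ‖ ≤ ‖ Δ ++ Σ ++ [ C ] ‖
  ‖‖-∷ʳ≤‖‖-insert Δ Σ {A} {C} wA≤wC rewrite ‖‖-∷ʳ Δ A | ‖‖-⊗ Δ Σ C =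
    +-mono-≤ (m≤m+n ‖ Δ ‖ ‖ Σ ‖) wA≤wC

  ‖‖-++-positive : ∀ Γ {Z C} → (0 < ‖ Z ‖ → 0 < w C) → 0 < ‖ Γ ++ Z ‖ → 0 < ‖ Γ ++ [ C ] ‖
  ‖‖-++-positive Γ {Z} {C} f h rewrite ‖‖-++ Γ Z | ‖‖-∷ʳ Γ C = +-positive ‖ Γ ‖ f h

  ‖‖-&-positive : ∀ Γ {A B C} → (0 < w A → 0 < w B → 0 < w C) →
                  0 < ‖ Γ ++ [ A ] ‖ → 0 < ‖ Γ ++ [ B ] ‖ → 0 < ‖ Γ ++ [ C ] ‖
  ‖‖-&-positive Γ {A} {B} {C} f h₁ h₂ rewrite ‖‖-∷ʳ Γ A | ‖‖-∷ʳ Γ B | ‖‖-∷ʳ Γ C =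
    +-positive₂ ‖ Γ ‖ f h₁ h₂

  ‖‖-⊗-positive : ∀ Δ Σ {A B C} → (0 < w A → 0 < w B → 0 < w C) →
                  0 < ‖ Δ ++ [ A ] ‖ → 0 < ‖ Σ ++ [ B ] ‖ → 0 < ‖ Δ ++ Σ ++ [ C ] ‖
  ‖‖-⊗-positive Δ Σ {A} {B} {C} f h₁ h₂ rewrite ‖‖-∷ʳ Δ A | ‖‖-∷ʳ Σ B | ‖‖-⊗ Δ Σ C =
    +-positive-⊗ ‖ Δ ‖ ‖ Σ ‖ f h₁ h₂

P Q P̄ Q̄ : Formula
P = pos 0
Q = pos 1
P̄ = ¬ᶠ P
Q̄ = ¬ᶠ Q

-- Without (par)

module Size = Weight (const 1)

size-invariant : ∀ {S} → S CR ≡ false → S parR ≡ false → Invariant S (λ Γ → 2 ≤ Size.‖ Γ ‖)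
size-invariant {S} noC noPar = record
  { resp-↭ = λ p → subst (2 ≤_) (Size.‖‖-↭ p)
  ; axiom  = λ _ → ≤-refl
  ; rule₁  = step₁
  ; rule₂  = step₂
  }
  where
  step₁ : ∀ {r Γ Δ} → S r ≡ true → Inst1 r Γ Δ → 2 ≤ Size.‖ Γ ‖ → 2 ≤ Size.‖ Δ ‖
  step₁ _  (⊕₁ Γ _ _)   h = ≤-trans h (Size.‖‖-∷ʳ-mono Γ ≤-refl)
  step₁ _  (⊕₂ Γ _ _)   h = ≤-trans h (Size.‖‖-∷ʳ-mono Γ ≤-refl)
  step₁ on (par _ _ _)  _ = ⊥-elim (rule-absent noPar on)
  step₁ _  (weak Γ A _) h = ≤-trans h (Size.‖‖-≤-++ Γ [ A ])
  step₁ on (contr _ _)  _ = ⊥-elim (rule-absent noC on)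

  step₂ : ∀ {r Γ₁ Γ₂ Δ} → S r ≡ true → Inst2 r Γ₁ Γ₂ Δ →
          2 ≤ Size.‖ Γ₁ ‖ → 2 ≤ Size.‖ Γ₂ ‖ → 2 ≤ Size.‖ Δ ‖
  step₂ _ (with& Γ _ _)  h _ = ≤-trans h (Size.‖‖-∷ʳ-mono Γ ≤-refl)
  step₂ _ (tens Δ Σ _ _) h _ = ≤-trans h (Size.‖‖-∷ʳ≤‖‖-insert Δ Σ ≤-refl)

P∨P̄-valid : Valid (P ∨ᶠ P̄)
P∨P̄-valid v with v 0
... | true  = refl
... | false = refl

par-required : ∀ {S} → S CR ≡ false → Complete S → S parR ≡ true
par-required noC complete = ¬-not λ noPar →
  1+n≰n (invariant-holds (size-invariant noC noPar) (complete (P ∨ᶠ P̄) P∨P̄-valid))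

-- Without (&)

weight : Formula → ℕ
weight (pos _)  = 1
weight (neg _)  = 1
weight (A ∧ᶠ B) = pred (weight A) + pred (weight B)
weight (A ∨ᶠ B) = weight A + weight B

module Wt = Weight weight

pred-bound : ∀ {k} m n → suc k ≤ m + n → k ≤ m + pred n
pred-bound m zero    h = ≤-trans (n≤1+n _) h
pred-bound m (suc n) h rewrite +-suc m n = s≤s⁻¹ h

tensor-bound : ∀ d s a b → 2 ≤ d + a → 2 ≤ s + b → 2 ≤ (d + s) + (pred a + pred b)
tensor-bound d s a b h₁ h₂ =
  subst (2 ≤_) (interchange +-commutativeSemigroup d (pred a) s (pred b))
    (+-mono-≤ (pred-bound d a h₁) (pred-bound s b h₂))

weight-invariant : ∀ {S} → S CR ≡ false → S &R ≡ false → Invariant S (λ Γ → 2 ≤ Wt.‖ Γ ‖)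
weight-invariant {S} noC no& = record
  { resp-↭ = λ p → subst (2 ≤_) (Wt.‖‖-↭ p)
  ; axiom  = λ _ → ≤-refl
  ; rule₁  = step₁
  ; rule₂  = step₂
  }
  where
  par-weight : ∀ Γ A B → Wt.‖ Γ ++ A ∷ B ∷ [] ‖ ≡ Wt.‖ Γ ++ [ A ∨ᶠ B ] ‖
  par-weight Γ A B = begin
    Wt.‖ Γ ++ A ∷ B ∷ [] ‖                     ≡⟨ Wt.‖‖-++ Γ (A ∷ B ∷ []) ⟩
    Wt.‖ Γ ‖ + (weight A + (weight B + 0))    ≡⟨ cong (λ x → Wt.‖ Γ ‖ + (weight A + x))
                                                      (+-identityʳ _) ⟩
    Wt.‖ Γ ‖ + weight (A ∨ᶠ B)                ≡⟨ Wt.‖‖-∷ʳ Γ (A ∨ᶠ B) ⟨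
    Wt.‖ Γ ++ [ A ∨ᶠ B ] ‖                     ∎
    where open ≡-Reasoning

  step₁ : ∀ {r Γ Δ} → S r ≡ true → Inst1 r Γ Δ → 2 ≤ Wt.‖ Γ ‖ → 2 ≤ Wt.‖ Δ ‖
  step₁ _  (⊕₁ Γ A₁ A₂) h = ≤-trans h (Wt.‖‖-∷ʳ-mono Γ (m≤m+n (weight A₁) (weight A₂)))
  step₁ _  (⊕₂ Γ A₁ A₂) h = ≤-trans h (Wt.‖‖-∷ʳ-mono Γ (m≤n+m (weight A₂) (weight A₁)))
  step₁ _  (par Γ A B)  h = subst (2 ≤_) (par-weight Γ A B) h
  step₁ _  (weak Γ A _) h = ≤-trans h (Wt.‖‖-≤-++ Γ [ A ])
  step₁ on (contr _ _)  _ = ⊥-elim (rule-absent noC on)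

  step₂ : ∀ {r Γ₁ Γ₂ Δ} → S r ≡ true → Inst2 r Γ₁ Γ₂ Δ →
          2 ≤ Wt.‖ Γ₁ ‖ → 2 ≤ Wt.‖ Γ₂ ‖ → 2 ≤ Wt.‖ Δ ‖
  step₂ on (with& _ _ _)  _  _  = ⊥-elim (rule-absent no& on)
  step₂ _  (tens Δ Σ A B) h₁ h₂ rewrite Wt.‖‖-⊗ Δ Σ (A ∧ᶠ B) =
    tensor-bound Wt.‖ Δ ‖ Wt.‖ Σ ‖ (weight A) (weight B)
      (subst (2 ≤_) (Wt.‖‖-∷ʳ Δ A) h₁) (subst (2 ≤_) (Wt.‖‖-∷ʳ Σ B) h₂)

P∨[P̄∧P̄]-valid : Valid (P ∨ᶠ (P̄ ∧ᶠ P̄))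
P∨[P̄∧P̄]-valid v with v 0
... | true  = refl
... | false = refl

&-required : ∀ {S} → S CR ≡ false → Complete S → S &R ≡ true
&-required noC complete = ¬-not λ no& →
  1+n≰n (invariant-holds (weight-invariant noC no&) (complete (P ∨ᶠ (P̄ ∧ᶠ P̄)) P∨[P̄∧P̄]-valid))

-- Without (W)

truth : (ℕ → Bool) → Formula → ℕ
truth ρ A = if eval ρ A then 1 else 0

module Truth (ρ : ℕ → Bool) = Weight (truth ρ)

#true : (ℕ → Bool) → Sequent → ℕ
#true ρ = Truth.‖_‖ ρ

ValidSequent : Sequent → Set
ValidSequent Γ = ∀ ρ → 0 < #true ρ Γ

module _ (ρ : ℕ → Bool) where

  ∨-sound₁ : ∀ A B → 0 < #true ρ [ A ] → 0 < truth ρ (A ∨ᶠ B)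
  ∨-sound₁ A B h with eval ρ A
  ∨-sound₁ A B h  | true  = s≤s z≤n
  ∨-sound₁ A B () | false

  ∨-sound₂ : ∀ A B → 0 < #true ρ [ B ] → 0 < truth ρ (A ∨ᶠ B)
  ∨-sound₂ A B h with eval ρ A | eval ρ B
  ∨-sound₂ A B h  | true  | _     = s≤s z≤n
  ∨-sound₂ A B h  | false | true  = s≤s z≤n
  ∨-sound₂ A B () | false | false

  par-sound : ∀ A B → 0 < #true ρ (A ∷ B ∷ []) → 0 < truth ρ (A ∨ᶠ B)
  par-sound A B h with eval ρ A | eval ρ B
  par-sound A B h  | true  | _     = s≤s z≤n
  par-sound A B h  | false | true  = s≤s z≤n
  par-sound A B () | false | false

  ∧-sound : ∀ A B → 0 < truth ρ A → 0 < truth ρ B → 0 < truth ρ (A ∧ᶠ B)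
  ∧-sound A B h₁ h₂ with eval ρ A | eval ρ B
  ∧-sound A B h₁ h₂ | true  | true = s≤s z≤n
  ∧-sound A B () h₂ | false | _
  ∧-sound A B h₁ () | true  | false

  axiom-sound : ∀ n → 0 < #true ρ (pos n ∷ neg n ∷ [])
  axiom-sound n with ρ n
  ... | true  = s≤s z≤n
  ... | false = s≤s z≤n

  contraction-sound : ∀ A → 0 < #true ρ (A ∷ A ∷ []) → 0 < truth ρ A
  contraction-sound A h with eval ρ A
  contraction-sound A h  | true  = s≤s z≤n
  contraction-sound A () | false

Inst1-sound : ∀ {r Γ Δ} → Inst1 r Γ Δ → ValidSequent Γ → ValidSequent Δ
Inst1-sound (⊕₁ Γ A₁ A₂)  v ρ = Truth.‖‖-++-positive ρ Γ (∨-sound₁ ρ A₁ A₂) (v ρ)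
Inst1-sound (⊕₂ Γ A₁ A₂)  v ρ = Truth.‖‖-++-positive ρ Γ (∨-sound₂ ρ A₁ A₂) (v ρ)
Inst1-sound (par Γ A B)   v ρ = Truth.‖‖-++-positive ρ Γ (par-sound ρ A B) (v ρ)
Inst1-sound (weak Γ A _)  v ρ = ≤-trans (v ρ) (Truth.‖‖-≤-++ ρ Γ [ A ])
Inst1-sound (contr Γ A)   v ρ = Truth.‖‖-++-positive ρ Γ (contraction-sound ρ A) (v ρ)

Inst2-sound : ∀ {r Γ₁ Γ₂ Δ} → Inst2 r Γ₁ Γ₂ Δ → ValidSequent Γ₁ → ValidSequent Γ₂ → ValidSequent Δ
Inst2-sound (with& Γ A B)  v₁ v₂ ρ = Truth.‖‖-&-positive ρ Γ (∧-sound ρ A B) (v₁ ρ) (v₂ ρ)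
Inst2-sound (tens Δ Σ A B) v₁ v₂ ρ = Truth.‖‖-⊗-positive ρ Δ Σ (∧-sound ρ A B) (v₁ ρ) (v₂ ρ)

data Literal : Formula → Set where
  pos : ∀ n → Literal (pos n)
  neg : ∀ n → Literal (neg n)

K H F : Formula
K = P ∧ᶠ (P ∧ᶠ Q)
H = K ∨ᶠ Q̄
F = P̄ ∨ᶠ H

F-valid : Valid F
F-valid v with v 0 | v 1
... | true  | true  = refl
... | true  | false = refl
... | false | _     = refl

assign : Bool → Bool → ℕ → Bool
assign p q zero    = p
assign p q (suc _) = q

-- The three sequents excluded below are F and the two sequents that (par) unfolds it to.
record WeakeningFree (Γ : Sequent) : Set where
  field
    valid         : ValidSequent Γ
    literals-only : All Literal Γ → length Γ ≤ 2
    ≁F            : ¬ (Γ ↭ [ F ])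
    ≁P̄H           : ¬ (Γ ↭ P̄ ∷ H ∷ [])
    ≁KP̄Q̄          : ¬ (Γ ↭ K ∷ P̄ ∷ Q̄ ∷ [])

open WeakeningFree

WeakeningFree-resp-↭ : ∀ {Γ Δ} → Γ ↭ Δ → WeakeningFree Γ → WeakeningFree Δ
WeakeningFree-resp-↭ p h = record
  { valid         = λ ρ → subst (0 <_) (Truth.‖‖-↭ ρ p) (valid h ρ)
  ; literals-only = λ lits → subst (_≤ 2) (↭-length p) (literals-only h (All-resp-↭ (↭-sym p) lits))
  ; ≁F            = λ q → ≁F h (↭-trans p q)
  ; ≁P̄H           = λ q → ≁P̄H h (↭-trans p q)
  ; ≁KP̄Q̄          = λ q → ≁KP̄Q̄ h (↭-trans p q)
  }

axiom-WeakeningFree : ∀ n → WeakeningFree (pos n ∷ neg n ∷ [])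
axiom-WeakeningFree n = record
  { valid         = λ ρ → axiom-sound ρ n
  ; literals-only = λ _ → ≤-refl
  ; ≁F            = λ q → case All-resp-↭ q lits of λ { (() ∷ _) }
  ; ≁P̄H           = λ q → case All-resp-↭ q lits of λ { (_ ∷ () ∷ _) }
  ; ≁KP̄Q̄          = λ q → case All-resp-↭ q lits of λ { (() ∷ _) }
  }
  where
  lits : All Literal (pos n ∷ neg n ∷ [])
  lits = pos n ∷ neg n ∷ []

last-∈ : ∀ (Γ : Sequent) {C : Formula} {X : Sequent} → Γ ++ [ C ] ↭ X → C ∈ X
last-∈ Γ p = ∈-resp-↭ p (∈-++⁺ʳ Γ (here refl))

drop-last : ∀ (Γ : Sequent) {C : Formula} (xs ys : Sequent) →
            Γ ++ [ C ] ↭ xs ++ [ C ] ++ ys → Γ ↭ xs ++ ys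
drop-last Γ xs ys p = subst (_↭ xs ++ ys) (++-identityʳ Γ) (drop-mid Γ xs p)

replace-last : ∀ (Γ : Sequent) {C : Formula} (xs ys Z : Sequent) →
               Γ ++ [ C ] ↭ xs ++ [ C ] ++ ys → Γ ++ Z ↭ (xs ++ ys) ++ Z
replace-last Γ xs ys Z p = ++⁺ʳ Z (drop-last Γ xs ys p)

¬All-Literal : ∀ (Γ : Sequent) {C : Formula} → ¬ Literal C → ¬ All Literal (Γ ++ [ C ])
¬All-Literal Γ ¬lit lits with ++⁻ʳ Γ lits
... | lit ∷ [] = ¬lit lit

∨-WeakeningFree : ∀ (Γ : Sequent) {A B : Formula} → let Δ = Γ ++ [ A ∨ᶠ B ] in
                  ValidSequent Δ → ¬ (Δ ↭ [ F ]) → ¬ (Δ ↭ P̄ ∷ H ∷ []) → WeakeningFree Δ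
∨-WeakeningFree Γ v ≁F ≁P̄H = record
  { valid         = v
  ; literals-only = λ lits → ⊥-elim (¬All-Literal Γ (λ ()) lits)
  ; ≁F            = ≁F
  ; ≁P̄H           = ≁P̄H
  ; ≁KP̄Q̄          = λ p → case last-∈ Γ p of λ
      { (here ()) ; (there (here ())) ; (there (there (here ()))) ; (there (there (there ()))) }
  }

∧-WeakeningFree : ∀ (Γ : Sequent) {A B : Formula} → let Δ = Γ ++ [ A ∧ᶠ B ] in
                  ValidSequent Δ → ¬ (Δ ↭ K ∷ P̄ ∷ Q̄ ∷ []) → WeakeningFree Δ
∧-WeakeningFree Γ v ≁KP̄Q̄ = record
  { valid         = v
  ; literals-only = λ lits → ⊥-elim (¬All-Literal Γ (λ ()) lits)
  ; ≁F            = λ p → case last-∈ Γ p of λ { (here ()) ; (there ()) }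
  ; ≁P̄H           = λ p → case last-∈ Γ p of λ
      { (here ()) ; (there (here ())) ; (there (there ())) }
  ; ≁KP̄Q̄          = ≁KP̄Q̄
  }

⊕₁-≁F : ∀ Γ A₁ A₂ → WeakeningFree (Γ ++ [ A₁ ]) → ¬ (Γ ++ [ A₁ ∨ᶠ A₂ ] ↭ [ F ])
⊕₁-≁F Γ A₁ A₂ h p with last-∈ Γ p
⊕₁-≁F Γ A₁ A₂ h p | here refl
  with () ← valid (WeakeningFree-resp-↭ (replace-last Γ [] [] [ P̄ ] p) h) (assign true true)

⊕₁-≁P̄H : ∀ Γ A₁ A₂ → WeakeningFree (Γ ++ [ A₁ ]) → ¬ (Γ ++ [ A₁ ∨ᶠ A₂ ] ↭ P̄ ∷ H ∷ [])
⊕₁-≁P̄H Γ A₁ A₂ h p with last-∈ Γ p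
⊕₁-≁P̄H Γ A₁ A₂ h p | there (here refl)
  with () ← valid (WeakeningFree-resp-↭ (replace-last Γ [ P̄ ] [] [ K ] p) h) (assign true false)

⊕₂-≁F : ∀ Γ A₁ A₂ → WeakeningFree (Γ ++ [ A₂ ]) → ¬ (Γ ++ [ A₁ ∨ᶠ A₂ ] ↭ [ F ])
⊕₂-≁F Γ A₁ A₂ h p with last-∈ Γ p
⊕₂-≁F Γ A₁ A₂ h p | here refl
  with () ← valid (WeakeningFree-resp-↭ (replace-last Γ [] [] [ H ] p) h) (assign false true)

⊕₂-≁P̄H : ∀ Γ A₁ A₂ → WeakeningFree (Γ ++ [ A₂ ]) → ¬ (Γ ++ [ A₁ ∨ᶠ A₂ ] ↭ P̄ ∷ H ∷ [])
⊕₂-≁P̄H Γ A₁ A₂ h p with last-∈ Γ p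
⊕₂-≁P̄H Γ A₁ A₂ h p | there (here refl)
  with () ← valid (WeakeningFree-resp-↭ (replace-last Γ [ P̄ ] [] [ Q̄ ] p) h) (assign true true)

par-≁F : ∀ Γ A B → WeakeningFree (Γ ++ A ∷ B ∷ []) → ¬ (Γ ++ [ A ∨ᶠ B ] ↭ [ F ])
par-≁F Γ A B h p with last-∈ Γ p
... | here refl = ≁P̄H h (replace-last Γ [] [] (P̄ ∷ H ∷ []) p)

par-≁P̄H : ∀ Γ A B → WeakeningFree (Γ ++ A ∷ B ∷ []) → ¬ (Γ ++ [ A ∨ᶠ B ] ↭ P̄ ∷ H ∷ [])
par-≁P̄H Γ A B h p with last-∈ Γ p
... | there (here refl) =
  ≁KP̄Q̄ h (↭-trans (replace-last Γ [ P̄ ] [] (K ∷ Q̄ ∷ []) p) (swap P̄ K ↭-refl))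

&-≁KP̄Q̄ : ∀ Γ A B → WeakeningFree (Γ ++ [ A ]) → ¬ (Γ ++ [ A ∧ᶠ B ] ↭ K ∷ P̄ ∷ Q̄ ∷ [])
&-≁KP̄Q̄ Γ A B h p with last-∈ Γ p
... | here refl = 1+n≰n (literals-only (WeakeningFree-resp-↭ moved h) (neg 0 ∷ neg 1 ∷ pos 0 ∷ []))
  where
  moved : Γ ++ [ P ] ↭ P̄ ∷ Q̄ ∷ P ∷ []
  moved = replace-last Γ [] (P̄ ∷ Q̄ ∷ []) [ P ] p
... | there (here ())
... | there (there (here ()))

⊗-≁KP̄Q̄ : ∀ Δ Σ A B → WeakeningFree (Δ ++ [ A ]) → WeakeningFree (Σ ++ [ B ]) →
          ¬ ((Δ ++ Σ) ++ [ A ∧ᶠ B ] ↭ K ∷ P̄ ∷ Q̄ ∷ [])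
⊗-≁KP̄Q̄ Δ Σ A B h₁ h₂ p with last-∈ (Δ ++ Σ) p
... | here refl = 1+n≰n (subst (2 ≤_) one-true (+-mono-≤ Δ-true Σ-true))
  where
  -- falsifies both P and P ∧ Q, and of P̄ , Q̄ makes only P̄ true
  ρ₀ : ℕ → Bool
  ρ₀ = assign false true
  Δ-true : 0 < #true ρ₀ Δ
  Δ-true = subst (0 <_) (trans (Truth.‖‖-∷ʳ ρ₀ Δ P) (+-identityʳ _)) (valid h₁ ρ₀)
  Σ-true : 0 < #true ρ₀ Σ
  Σ-true = subst (0 <_) (trans (Truth.‖‖-∷ʳ ρ₀ Σ (P ∧ᶠ Q)) (+-identityʳ _)) (valid h₂ ρ₀)
  one-true : #true ρ₀ Δ + #true ρ₀ Σ ≡ 1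
  one-true = trans (sym (Truth.‖‖-++ ρ₀ Δ Σ))
                   (Truth.‖‖-↭ ρ₀ (drop-last (Δ ++ Σ) [] (P̄ ∷ Q̄ ∷ []) p))
... | there (here ())
... | there (there (here ()))

weakening-free-invariant : ∀ {S} → S CR ≡ false → S WR ≡ false → Invariant S WeakeningFree
weakening-free-invariant {S} noC noW = record
  { resp-↭ = WeakeningFree-resp-↭
  ; axiom  = axiom-WeakeningFree
  ; rule₁  = step₁
  ; rule₂  = step₂
  }
  where
  step₁ : ∀ {r Γ Δ} → S r ≡ true → Inst1 r Γ Δ → WeakeningFree Γ → WeakeningFree Δ
  step₁ _  i@(⊕₁ Γ A₁ A₂) h =
    ∨-WeakeningFree Γ (Inst1-sound i (valid h)) (⊕₁-≁F Γ A₁ A₂ h) (⊕₁-≁P̄H Γ A₁ A₂ h)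
  step₁ _  i@(⊕₂ Γ A₁ A₂) h =
    ∨-WeakeningFree Γ (Inst1-sound i (valid h)) (⊕₂-≁F Γ A₁ A₂ h) (⊕₂-≁P̄H Γ A₁ A₂ h)
  step₁ _  i@(par Γ A B)  h =
    ∨-WeakeningFree Γ (Inst1-sound i (valid h)) (par-≁F Γ A B h) (par-≁P̄H Γ A B h)
  step₁ on (weak _ _ _)   _ = ⊥-elim (rule-absent noW on)
  step₁ on (contr _ _)    _ = ⊥-elim (rule-absent noC on)

  step₂ : ∀ {r Γ₁ Γ₂ Δ} → S r ≡ true → Inst2 r Γ₁ Γ₂ Δ →
          WeakeningFree Γ₁ → WeakeningFree Γ₂ → WeakeningFree Δ
  step₂ _ i@(with& Γ A B)  h₁ h₂ =
    ∧-WeakeningFree Γ (Inst2-sound i (valid h₁) (valid h₂)) (&-≁KP̄Q̄ Γ A B h₁)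
  step₂ _ i@(tens Δ Σ A B) h₁ h₂ = subst WeakeningFree (++-assoc Δ Σ [ A ∧ᶠ B ])
    (∧-WeakeningFree (Δ ++ Σ)
      (subst ValidSequent (sym (++-assoc Δ Σ [ A ∧ᶠ B ])) (Inst2-sound i (valid h₁) (valid h₂)))
      (⊗-≁KP̄Q̄ Δ Σ A B h₁ h₂))

W-required : ∀ {S} → S CR ≡ false → Complete S → S WR ≡ true
W-required noC complete = ¬-not λ noW →
  ≁F (invariant-holds (weakening-free-invariant noC noW) (complete F F-valid)) ↭-refl

lemma16 : ∀ (S : System) → S CR ≡ false → Complete S → Contains S Np
lemma16 S noC complete r r∈Np = enabled-rule-derivable (present r r∈Np)
  where
  present : ∀ r → Np r ≡ true → S r ≡ true
  present &R   _ = &-required noC complete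
  present parR _ = par-required noC complete
  present WR   _ = W-required noC complete
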